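{- Let $N$ be an integer matrix with rows $r_1,\dots,r_p$, let $k$ be a positive integer, and suppose that the block matrix $M$ obtained by stacking $k$ copies of $N$ vertically is square. Let $i\neq j$ and let $c$ be an integer. Let $M'$ be the matrix obtained from $M$ by replacing, in each of the $k$ blocks, the row $r_i$ with $r_i+c\,r_j$. Then $\mathrm{Perm}(M)\equiv\mathrm{Perm}(M')\pmod{k+1}$.
   Context: The permanent of an $n\times n$ matrix $A=(a_{i,j})$ is $\mathrm{Perm}(A)=\sum_{\sigma\in S_n}\prod_{i=1}^n a_{i,\sigma(i)}$. -}

module Defs where

open import Data.Nat using (ℕ; zero; suc) renaming (_*_ to _*ℕ_)
open import Data.Integer using (ℤ; _+_; _*_; +_)
open import Data.Fin using (Fin; zero; suc; punchIn)
open import Data.Fin.Base using (remQuot)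
open import Data.List using (List; []; _∷_; map; concatMap; foldr)
open import Data.Product using (proj₂)
open import Relation.Binary.PropositionalEquality using (_≡_)
open import Relation.Nullary using (Dec; yes; no)
open import Data.Fin using (_≟_)

Matrix : ℕ → ℕ → Set
Matrix m n = Fin m → Fin n → ℤ

allFin : (n : ℕ) → List (Fin n)
allFin zero    = []
allFin (suc n) = zero ∷ map suc (allFin n)

-- The list of all permutations of Fin n (each bijection Fin n → Fin n
-- occurs exactly once): σ(0) = i, and σ restricted to the remaining
-- points is a permutation of Fin n followed by punchIn i.
perms : (n : ℕ) → List (Fin n → Fin n)
perms zero    = (λ ()) ∷ []
perms (suc n) =
  concatMap (λ i → map (λ τ → λ { zero → i ; (suc x) → punchIn i (τ x) }) (perms n))
            (allFin (suc n))

sumℤ : List ℤ → ℤ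
sumℤ = foldr _+_ (+ 0)

prodℤ : List ℤ → ℤ
prodℤ = foldr _*_ (+ 1)

Perm : {n : ℕ} → Matrix n n → ℤ
Perm {n} A = sumℤ (map (λ σ → prodℤ (map (λ i → A i (σ i)) (allFin n))) (perms n))

-- Stack k copies of a (p × q) matrix vertically: row r of the result, with
-- r = b·p + i (b the block index), is row i of N.
stack : (k : ℕ) {p q : ℕ} → Matrix p q → Matrix (k *ℕ p) q
stack k {p} N r = N (proj₂ (remQuot {k} p r))

addRowMultiple : {p q : ℕ} → Fin p → Fin p → ℤ → Matrix p q → Matrix p q
addRowMultiple i j c N r with r ≟ i
... | yes _ = λ col → N i col + c * N j col
... | no  _ = N r

module Submission where

-- The argument works with the permanent of a LIST of rows of length n, defined by expansion along the
-- first row (for r ≤ n rows it is the sum over injective assignments of columns to rows).  We show: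
--   * Perm A is this permanent of the list of rows of A;
--   * it is invariant under permuting the rows and linear in the first row;
--   * expanding along column 0, a list containing the same row m+1 times has permanent divisible by
--     m+1 (the m+1 choices of which copy takes column 0 give equal terms, and induction);
--   * replacing the k copies of a by a + c·b one at a time, each step changes the permanent by c times
--     the permanent of a list with k+1 copies of b, hence by a multiple of k+1.
-- Finally the rows of the stacked matrices are rearranged into the form
-- a^k ++ b^k ++ (the other rows) required by the last step.

module RowPermanents where

  open import Defs
  open import Data.Nat using (ℕ; zero; suc) renaming (_*_ to _*ℕ_; _+_ to _+ℕ_)
  open import Data.Integer using (ℤ; +_; _+_; _-_; _*_)
  open import Data.Integer.Properties
    using (*-zeroʳ; *-zeroˡ; *-identityˡ; +-identityˡ; +-assoc; +-inverseʳ; *-distribˡ-+)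
  open import Data.Integer.Tactic.RingSolver using (solve-∀)
  open import Data.Integer.Divisibility.Signed
    using (_∣_; divides; ∣m∣n⇒∣m+n; ∣m∣n⇒∣m-n; ∣n⇒∣m*n; ∣m⇒∣m*n; ∣-refl)
  open import Data.Fin using (Fin; zero; suc; punchIn; punchOut; _↑ˡ_; _↑ʳ_; _≟_; remQuot)
  open import Data.Fin.Properties using (remQuot-combine; splitAt-↑ʳ; punchInᵢ≢i; punchIn-punchOut)
  open import Data.List using (List; []; _∷_; map; _++_; replicate; concatMap)
  open import Data.List.Properties using (map-++; map-replicate; map-∘; map-cong; map-cong-local; map-id; ++-assoc)
  open import Data.List.Relation.Unary.All as All using (All; universal)
  open import Data.List.Relation.Unary.All.Properties using () renaming (map⁺ to All-map⁺)
  open import Data.List.Relation.Binary.Pointwise as Pointwise using (Pointwise; []; _∷_)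
  open import Data.List.Relation.Binary.Permutation.Propositional
    using (_↭_; ↭-sym; ↭-reflexive) renaming (refl to ↭-refl; prep to ↭-prep; swap to ↭-swap; trans to ↭-trans)
  open import Data.List.Relation.Binary.Permutation.Propositional.Properties
    using (shift; shifts; ++⁺; ++⁺ˡ) renaming (map⁺ to ↭-map⁺)
  open import Data.Product using (_×_; _,_; proj₁; proj₂; ∃)
  import Data.Product as Product
  open import Function using (_∘_)
  open import Relation.Nullary using (yes; no)
  open import Relation.Nullary.Negation using (contradiction)
  open import Relation.Binary.PropositionalEquality
  open ≡-Reasoning

  ∑ : {A : Set} → List A → (A → ℤ) → ℤ
  ∑ xs f = sumℤ (map f xs)

  ∑Fin : (n : ℕ) → (Fin n → ℤ) → ℤ
  ∑Fin n = ∑ (allFin n)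

  ∑-cong : {A : Set} (xs : List A) {f g : A → ℤ} → (∀ x → f x ≡ g x) → ∑ xs f ≡ ∑ xs g
  ∑-cong []       f≗g = refl
  ∑-cong (x ∷ xs) f≗g = cong₂ _+_ (f≗g x) (∑-cong xs f≗g)

  ∑-zero : {A : Set} (xs : List A) {f : A → ℤ} → (∀ x → f x ≡ + 0) → ∑ xs f ≡ + 0
  ∑-zero []       f≗0 = refl
  ∑-zero (x ∷ xs) f≗0 = cong₂ _+_ (f≗0 x) (∑-zero xs f≗0)

  ∑-+ : {A : Set} (xs : List A) (f g : A → ℤ) → ∑ xs (λ x → f x + g x) ≡ ∑ xs f + ∑ xs g
  ∑-+ []       f g = refl
  ∑-+ (x ∷ xs) f g = trans (cong (_+_ (f x + g x)) (∑-+ xs f g)) (interchange (f x) (g x) _ _)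
    where interchange : ∀ a b c d → a + b + (c + d) ≡ a + c + (b + d)
          interchange = solve-∀

  ∑-*ˡ : {A : Set} (xs : List A) (c : ℤ) (f : A → ℤ) → ∑ xs (λ x → c * f x) ≡ c * ∑ xs f
  ∑-*ˡ []       c f = sym (*-zeroʳ c)
  ∑-*ˡ (x ∷ xs) c f = trans (cong (_+_ (c * f x)) (∑-*ˡ xs c f)) (sym (*-distribˡ-+ c (f x) (∑ xs f)))

  ∑-map : {A B : Set} (xs : List A) (h : A → B) (f : B → ℤ) → ∑ (map h xs) f ≡ ∑ xs (f ∘ h)
  ∑-map []       h f = refl
  ∑-map (x ∷ xs) h f = cong (_+_ (f (h x))) (∑-map xs h f)

  ∑-++ : {A : Set} (xs ys : List A) (f : A → ℤ) → ∑ (xs ++ ys) f ≡ ∑ xs f + ∑ ys f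
  ∑-++ []       ys f = sym (+-identityˡ (∑ ys f))
  ∑-++ (x ∷ xs) ys f = trans (cong (_+_ (f x)) (∑-++ xs ys f)) (sym (+-assoc (f x) (∑ xs f) (∑ ys f)))

  ∑-concatMap : {A B : Set} (xs : List A) (h : A → List B) (f : B → ℤ) →
                ∑ (concatMap h xs) f ≡ ∑ xs (λ x → ∑ (h x) f)
  ∑-concatMap []       h f = refl
  ∑-concatMap (x ∷ xs) h f = trans (∑-++ (h x) (concatMap h xs) f) (cong (_+_ (∑ (h x) f)) (∑-concatMap xs h f))

  ∑-comm : {A B : Set} (xs : List A) (ys : List B) (F : A → B → ℤ) →
           ∑ xs (λ x → ∑ ys (F x)) ≡ ∑ ys (λ y → ∑ xs (λ x → F x y))
  ∑-comm []       ys F = sym (∑-zero ys (λ _ → refl))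
  ∑-comm (x ∷ xs) ys F = trans (cong (_+_ (∑ ys (F x))) (∑-comm xs ys F)) (sym (∑-+ ys (F x) _))

  ∑-comm-weighted : {A B : Set} (xs : List A) (ys : List B) (f : A → ℤ) (g : B → ℤ) (W : A → B → ℤ) →
    ∑ xs (λ x → f x * ∑ ys (λ y → g y * W x y)) ≡ ∑ ys (λ y → g y * ∑ xs (λ x → f x * W x y))
  ∑-comm-weighted xs ys f g W = begin
    ∑ xs (λ x → f x * ∑ ys (λ y → g y * W x y))
      ≡⟨ ∑-cong xs (λ x → sym (∑-*ˡ ys (f x) (λ y → g y * W x y))) ⟩
    ∑ xs (λ x → ∑ ys (λ y → f x * (g y * W x y)))
      ≡⟨ ∑-comm xs ys (λ x y → f x * (g y * W x y)) ⟩
    ∑ ys (λ y → ∑ xs (λ x → f x * (g y * W x y)))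
      ≡⟨ ∑-cong ys (λ y → trans (∑-cong xs (λ x → commute (f x) (g y) (W x y)))
                                (∑-*ˡ xs (g y) (λ x → f x * W x y))) ⟩
    ∑ ys (λ y → g y * ∑ xs (λ x → f x * W x y)) ∎
    where commute : ∀ a b c → a * (b * c) ≡ b * (a * c)
          commute = solve-∀

  ∑-∣ : {A : Set} {d : ℤ} (xs : List A) {f : A → ℤ} → (∀ x → d ∣ f x) → d ∣ ∑ xs f
  ∑-∣ {d = d} []       d∣f = divides (+ 0) (sym (*-zeroˡ d))
  ∑-∣         (x ∷ xs) d∣f = ∣m∣n⇒∣m+n (d∣f x) (∑-∣ xs d∣f)

  ∑Fin-suc : (n : ℕ) (f : Fin (suc n) → ℤ) → ∑Fin (suc n) f ≡ f zero + ∑Fin n (f ∘ suc)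
  ∑Fin-suc n f = cong (_+_ (f zero)) (∑-map (allFin n) suc f)

  Row : ℕ → Set
  Row n = Fin n → ℤ

  restrict : {m n : ℕ} → (Fin m → Fin n) → Row n → Row m
  restrict e r = r ∘ e

  deleteCol : {n : ℕ} → Fin (suc n) → Row (suc n) → Row n
  deleteCol i = restrict (punchIn i)

  rperm : (n : ℕ) → List (Row n) → ℤ
  rperm n       []       = + 1
  rperm zero    (_ ∷ _)  = + 0
  rperm (suc n) (x ∷ rs) = ∑Fin (suc n) (λ i → x i * rperm n (map (deleteCol i) rs))

  Perm-firstRow : (n : ℕ) (A : Matrix (suc n) (suc n)) →
    Perm A ≡ ∑Fin (suc n) (λ i → A zero i * Perm (λ x y → A (suc x) (punchIn i y)))
  Perm-firstRow n A = expand _ (λ _ _ → refl) (λ _ _ _ → refl)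
    where
    term : (Fin (suc n) → Fin (suc n)) → ℤ
    term σ = prodℤ (map (λ l → A l (σ l)) (allFin (suc n)))
    minor : Fin (suc n) → (Fin n → Fin n) → ℤ
    minor i τ = prodℤ (map (λ l → A (suc l) (punchIn i (τ l))) (allFin n))
    -- perms (suc n) extends each τ ∈ perms n by σ 0 = i; only these two equations about it are needed
    expand : (extend : Fin (suc n) → (Fin n → Fin n) → Fin (suc n) → Fin (suc n)) →
             (∀ i τ → extend i τ zero ≡ i) → (∀ i τ x → extend i τ (suc x) ≡ punchIn i (τ x)) →
             ∑ (concatMap (λ i → map (extend i) (perms n)) (allFin (suc n))) term
               ≡ ∑Fin (suc n) (λ i → A zero i * ∑ (perms n) (minor i))
    expand extend at-zero at-suc = begin
      ∑ (concatMap (λ i → map (extend i) (perms n)) (allFin (suc n))) term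
        ≡⟨ ∑-concatMap (allFin (suc n)) (λ i → map (extend i) (perms n)) term ⟩
      ∑Fin (suc n) (λ i → ∑ (map (extend i) (perms n)) term)
        ≡⟨ ∑-cong (allFin (suc n)) (λ i → ∑-map (perms n) (extend i) term) ⟩
      ∑Fin (suc n) (λ i → ∑ (perms n) (λ τ → term (extend i τ)))
        ≡⟨ ∑-cong (allFin (suc n)) (λ i → ∑-cong (perms n) (λ τ → term-extend i τ)) ⟩
      ∑Fin (suc n) (λ i → ∑ (perms n) (λ τ → A zero i * minor i τ))
        ≡⟨ ∑-cong (allFin (suc n)) (λ i → ∑-*ˡ (perms n) (A zero i) (minor i)) ⟩
      ∑Fin (suc n) (λ i → A zero i * ∑ (perms n) (minor i)) ∎
      where
      term-extend : ∀ i τ → term (extend i τ) ≡ A zero i * minor i τ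
      term-extend i τ = cong₂ (λ a z → A zero a * prodℤ z) (at-zero i τ)
        (trans (sym (map-∘ (allFin n))) (map-cong (λ l → cong (A (suc l)) (at-suc i τ l)) (allFin n)))

  Perm≡rperm : (n : ℕ) (A : Matrix n n) → Perm A ≡ rperm n (map A (allFin n))
  Perm≡rperm zero    A = refl
  Perm≡rperm (suc n) A = trans (Perm-firstRow n A) (∑-cong (allFin (suc n)) λ i →
    cong (A zero i *_) (trans (Perm≡rperm n _) (cong (rperm n) (sym (minor-rows i)))))
    where
    minor-rows : ∀ i → map (deleteCol i) (map A (map suc (allFin n)))
                         ≡ map (λ x y → A (suc x) (punchIn i y)) (allFin n)
    minor-rows i = trans (sym (map-∘ _)) (sym (map-∘ (allFin n)))

  rperm-cong : (n : ℕ) {xs ys : List (Row n)} → Pointwise _≗_ xs ys → rperm n xs ≡ rperm n ys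
  rperm-cong n       []           = refl
  rperm-cong zero    (_ ∷ _)      = refl
  rperm-cong (suc n) (x≗y ∷ rs≗ss) = ∑-cong (allFin (suc n)) λ i →
    cong₂ _*_ (x≗y i) (rperm-cong n (Pointwise.map⁺ (deleteCol i) (deleteCol i)
                                       (Pointwise.map (λ r≗s → r≗s ∘ punchIn i) rs≗ss)))

  -- The two-row expansion Σ_i Σ_j x_i y_{i'} G(e_{ij}) of rperm (x ∷ y ∷ rs), where i' = punchIn i j is
  -- the j-th column left after deleting i and G e is the permanent of rs restricted to the columns e.
  pairSum : (m : ℕ) (x y : Row (suc (suc m))) (G : (Fin m → Fin (suc (suc m))) → ℤ) → ℤ
  pairSum m x y G =
    ∑Fin (suc (suc m)) (λ i → x i * ∑Fin (suc m) (λ j → y (punchIn i j) * G (punchIn i ∘ punchIn j)))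

  Extensional : {m n : ℕ} → ((Fin m → Fin n) → ℤ) → Set
  Extensional G = ∀ {e e'} → e ≗ e' → G e ≡ G e'

  module PairSumSymmetry where
    -- Splitting off i = 0 and then j = 0 leaves pairSum on the columns 1, 2, …: the terms where x or y
    -- takes column 0 are x₀·avoid0 y + y₀·avoid0 x, the rest is bothAvoid0.
    avoid0 : (m : ℕ) (y : Row (suc (suc m))) (G : (Fin m → Fin (suc (suc m))) → ℤ) → ℤ
    avoid0 m y G = ∑Fin (suc m) (λ j → y (suc j) * G (suc ∘ punchIn j))

    bothAvoid0 : (m : ℕ) (x y : Row (suc (suc m))) (G : (Fin m → Fin (suc (suc m))) → ℤ) → ℤ
    bothAvoid0 m x y G = ∑Fin (suc m) (λ i → x (suc i) *
      ∑Fin m (λ j → y (suc (punchIn i j)) * G (punchIn (suc i) ∘ punchIn (suc j))))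

    split0 : ∀ m x y G → pairSum m x y G ≡ x zero * avoid0 m y G + (y zero * avoid0 m x G + bothAvoid0 m x y G)
    split0 m x y G = begin
      pairSum m x y G
        ≡⟨ ∑Fin-suc (suc m) (λ i → x i * ∑Fin (suc m) (λ j → y (punchIn i j) * G (punchIn i ∘ punchIn j))) ⟩
      x zero * avoid0 m y G + ∑Fin (suc m) (λ i → x (suc i) * ∑Fin (suc m) (inner i))
        ≡⟨ cong (_+_ (x zero * avoid0 m y G)) (∑-cong (allFin (suc m)) λ i →
             trans (cong (x (suc i) *_) (∑Fin-suc m (inner i))) (distrib (x (suc i)) (y zero) _ _)) ⟩
      x zero * avoid0 m y G + ∑Fin (suc m) (λ i → y zero * (x (suc i) * G (suc ∘ punchIn i)) + rest i)
        ≡⟨ cong (_+_ (x zero * avoid0 m y G))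
                (∑-+ (allFin (suc m)) (λ i → y zero * (x (suc i) * G (suc ∘ punchIn i))) rest) ⟩
      x zero * avoid0 m y G + (∑Fin (suc m) (λ i → y zero * (x (suc i) * G (suc ∘ punchIn i))) + bothAvoid0 m x y G)
        ≡⟨ cong (λ s → x zero * avoid0 m y G + (s + bothAvoid0 m x y G)) (∑-*ˡ (allFin (suc m)) (y zero) _) ⟩
      x zero * avoid0 m y G + (y zero * avoid0 m x G + bothAvoid0 m x y G) ∎
      where
      inner : Fin (suc m) → Fin (suc m) → ℤ
      inner i j = y (punchIn (suc i) j) * G (punchIn (suc i) ∘ punchIn j)
      rest : Fin (suc m) → ℤ
      rest i = x (suc i) * ∑Fin m (λ j → y (suc (punchIn i j)) * G (punchIn (suc i) ∘ punchIn (suc j)))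
      distrib : ∀ a b g s → a * (b * g + s) ≡ b * (a * g) + a * s
      distrib = solve-∀

    -- On columns 1, 2, … the embeddings punchIn (suc i) ∘ punchIn (suc j) are lifts of punchIn i ∘ punchIn j.
    lift : {m n : ℕ} → (Fin m → Fin n) → Fin (suc m) → Fin (suc n)
    lift e zero    = zero
    lift e (suc z) = suc (e z)

    bothAvoid0≡pairSum : ∀ m x y G → Extensional G →
      bothAvoid0 (suc m) x y G ≡ pairSum m (x ∘ suc) (y ∘ suc) (G ∘ lift)
    bothAvoid0≡pairSum m x y G ext = ∑-cong (allFin (suc (suc m))) λ i → cong (x (suc i) *_)
      (∑-cong (allFin (suc m)) λ j → cong (y (suc (punchIn i j)) *_) (ext λ { zero → refl ; (suc z) → refl }))

    pairSum-sym : ∀ m x y G → Extensional G → pairSum m x y G ≡ pairSum m y x G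
    bothAvoid0-sym : ∀ m x y G → Extensional G → bothAvoid0 m x y G ≡ bothAvoid0 m y x G

    pairSum-sym m x y G ext = begin
      pairSum m x y G
        ≡⟨ split0 m x y G ⟩
      X + (Y + bothAvoid0 m x y G)
        ≡⟨ cong (λ r → X + (Y + r)) (bothAvoid0-sym m x y G ext) ⟩
      X + (Y + bothAvoid0 m y x G)
        ≡⟨ swap-front X Y (bothAvoid0 m y x G) ⟩
      Y + (X + bothAvoid0 m y x G)
        ≡⟨ sym (split0 m y x G) ⟩
      pairSum m y x G ∎
      where
      X Y : ℤ
      X = x zero * avoid0 m y G
      Y = y zero * avoid0 m x G
      swap-front : ∀ a b r → a + (b + r) ≡ b + (a + r)
      swap-front = solve-∀

    bothAvoid0-sym zero    x y G ext =
      trans (∑-zero (allFin 1) (λ i → *-zeroʳ (x (suc i)))) (sym (∑-zero (allFin 1) (λ i → *-zeroʳ (y (suc i)))))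
    bothAvoid0-sym (suc m) x y G ext = begin
      bothAvoid0 (suc m) x y G                  ≡⟨ bothAvoid0≡pairSum m x y G ext ⟩
      pairSum m (x ∘ suc) (y ∘ suc) (G ∘ lift)  ≡⟨ pairSum-sym m (x ∘ suc) (y ∘ suc) (G ∘ lift) lift-ext ⟩
      pairSum m (y ∘ suc) (x ∘ suc) (G ∘ lift)  ≡⟨ sym (bothAvoid0≡pairSum m y x G ext) ⟩
      bothAvoid0 (suc m) y x G                  ∎
      where lift-ext : Extensional (G ∘ lift)
            lift-ext e≗e' = ext λ { zero → refl ; (suc z) → cong suc (e≗e' z) }

  open PairSumSymmetry using (pairSum-sym)

  rperm-swap : (n : ℕ) (x y : Row n) (rs : List (Row n)) → rperm n (x ∷ y ∷ rs) ≡ rperm n (y ∷ x ∷ rs)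
  rperm-swap zero          x y rs = refl
  rperm-swap (suc zero)    x y rs = cong (_+ + 0) (trans (*-zeroʳ (x zero)) (sym (*-zeroʳ (y zero))))
  rperm-swap (suc (suc m)) x y rs =
    trans (twoRows x y) (trans (pairSum-sym m x y G G-ext) (sym (twoRows y x)))
    where
    G : (Fin m → Fin (suc (suc m))) → ℤ
    G e = rperm m (map (restrict e) rs)
    G-ext : Extensional G
    G-ext {e} {e'} e≗e' = rperm-cong m (Pointwise.map⁺ (restrict e) (restrict e')
                                 (Pointwise.refl (λ {r} z → cong r (e≗e' z)) {rs}))
    twoRows : ∀ x y → rperm (suc (suc m)) (x ∷ y ∷ rs) ≡ pairSum m x y G
    twoRows x y = ∑-cong (allFin (suc (suc m))) λ i → cong (x i *_) (∑-cong (allFin (suc m)) λ j →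
      cong (λ rows → y (punchIn i j) * rperm m rows) (sym (map-∘ rs)))

  rperm-↭ : (n : ℕ) {xs ys : List (Row n)} → xs ↭ ys → rperm n xs ≡ rperm n ys
  rperm-prep : (n : ℕ) (x : Row n) {xs ys : List (Row n)} → xs ↭ ys → rperm n (x ∷ xs) ≡ rperm n (x ∷ ys)

  rperm-prep zero    x xs↭ys = refl
  rperm-prep (suc n) x xs↭ys = ∑-cong (allFin (suc n)) λ i →
    cong (x i *_) (rperm-↭ n (↭-map⁺ (deleteCol i) xs↭ys))

  rperm-↭ n ↭-refl              = refl
  rperm-↭ n (↭-prep x p)        = rperm-prep n x p
  rperm-↭ n (↭-swap x y p)      = trans (rperm-swap n x y _) (rperm-prep n y (↭-prep x p))
  rperm-↭ n (↭-trans p q)       = trans (rperm-↭ n p) (rperm-↭ n q)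

  _⊕_·_ : {n : ℕ} → Row n → ℤ → Row n → Row n
  (a ⊕ c · b) z = a z + c * b z

  rperm-linear : (n : ℕ) (a b : Row n) (c : ℤ) (rs : List (Row n)) →
    rperm n ((a ⊕ c · b) ∷ rs) ≡ rperm n (a ∷ rs) + c * rperm n (b ∷ rs)
  rperm-linear zero    a b c rs = sym (zero-sum c)
    where zero-sum : ∀ c → + 0 + c * + 0 ≡ + 0
          zero-sum = solve-∀
  rperm-linear (suc n) a b c rs = begin
    ∑Fin (suc n) (λ i → (a i + c * b i) * Q i)
      ≡⟨ ∑-cong (allFin (suc n)) (λ i → distrib (a i) (b i) c (Q i)) ⟩
    ∑Fin (suc n) (λ i → a i * Q i + c * (b i * Q i))
      ≡⟨ ∑-+ (allFin (suc n)) (λ i → a i * Q i) (λ i → c * (b i * Q i)) ⟩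
    rperm (suc n) (a ∷ rs) + ∑Fin (suc n) (λ i → c * (b i * Q i))
      ≡⟨ cong (_+_ (rperm (suc n) (a ∷ rs))) (∑-*ˡ (allFin (suc n)) c _) ⟩
    rperm (suc n) (a ∷ rs) + c * rperm (suc n) (b ∷ rs) ∎
    where
    Q : Fin (suc n) → ℤ
    Q i = rperm n (map (deleteCol i) rs)
    distrib : ∀ a b c q → (a + c * b) * q ≡ a * q + c * (b * q)
    distrib = solve-∀

  -- Expansion along column 0.

  selections : {A : Set} → List A → List (A × List A)
  selections []       = []
  selections (x ∷ xs) = (x , xs) ∷ map (Product.map₂ (x ∷_)) (selections xs)

  selections-map : {A B : Set} (f : A → B) (xs : List A) →
    selections (map f xs) ≡ map (Product.map f (map f)) (selections xs)
  selections-map f []       = refl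
  selections-map f (x ∷ xs) = cong ((f x , map f xs) ∷_) (begin
    map (Product.map₂ (f x ∷_)) (selections (map f xs))
      ≡⟨ cong (map (Product.map₂ (f x ∷_))) (selections-map f xs) ⟩
    map (Product.map₂ (f x ∷_)) (map (Product.map f (map f)) (selections xs))
      ≡⟨ sym (map-∘ (selections xs)) ⟩
    map (Product.map f (map f) ∘ Product.map₂ (x ∷_)) (selections xs)
      ≡⟨ map-∘ (selections xs) ⟩
    map (Product.map f (map f)) (map (Product.map₂ (x ∷_)) (selections xs)) ∎)

  ∑-selections-map : {A B : Set} (f : A → B) (xs : List A) (F : B × List B → ℤ) →
    ∑ (selections (map f xs)) F ≡ ∑ (selections xs) (F ∘ Product.map f (map f))
  ∑-selections-map f xs F = trans (cong (λ ss → ∑ ss F) (selections-map f xs)) (∑-map (selections xs) _ F)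

  tail : {n : ℕ} → Row (suc n) → Row n
  tail = deleteCol zero

  tail-deleteCol : {n : ℕ} (i : Fin (suc n)) (ys : List (Row (suc (suc n)))) →
    map tail (map (deleteCol (suc i)) ys) ≡ map (deleteCol i) (map tail ys)
  tail-deleteCol i ys = trans (sym (map-∘ ys)) (map-∘ ys)

  -- Either column 0 is used by no row, or by exactly one selected row.
  column0Expansion : (n : ℕ) → List (Row (suc n)) → ℤ
  column0Expansion n rs =
    rperm n (map tail rs) + ∑ (selections rs) (λ s → proj₁ s zero * rperm n (map tail (proj₂ s)))

  rperm-column0 : (n : ℕ) (rs : List (Row (suc n))) → rperm (suc n) rs ≡ column0Expansion n rs

  firstRow-avoiding0 : (n : ℕ) (x : Row (suc n)) (xs : List (Row (suc n))) →
    ∑Fin n (λ i → x (suc i) * rperm n (map (deleteCol (suc i)) xs))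
      ≡ rperm n (tail x ∷ map tail xs)
        + ∑ (selections xs) (λ s → proj₁ s zero * rperm n (tail x ∷ map tail (proj₂ s)))
  firstRow-avoiding0 zero    x xs =
    sym (cong (_+_ (+ 0)) (∑-zero (selections xs) (λ s → *-zeroʳ (proj₁ s zero))))
  firstRow-avoiding0 (suc m) x xs = begin
    ∑Fin (suc m) (λ i → x (suc i) * rperm (suc m) (map (deleteCol (suc i)) xs))
      ≡⟨ ∑-cong (allFin (suc m)) (λ i → cong (x (suc i) *_) (minor-column0 i)) ⟩
    ∑Fin (suc m) (λ i → x (suc i) * (U i + ∑ (selections xs) (V i)))
      ≡⟨ ∑-cong (allFin (suc m)) (λ i → *-distribˡ-+ (x (suc i)) (U i) _) ⟩
    ∑Fin (suc m) (λ i → x (suc i) * U i + x (suc i) * ∑ (selections xs) (V i))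
      ≡⟨ ∑-+ (allFin (suc m)) (λ i → x (suc i) * U i) (λ i → x (suc i) * ∑ (selections xs) (V i)) ⟩
    rperm (suc m) (tail x ∷ map tail xs) + ∑Fin (suc m) (λ i → x (suc i) * ∑ (selections xs) (V i))
      ≡⟨ cong (_+_ (rperm (suc m) (tail x ∷ map tail xs)))
              (∑-comm-weighted (allFin (suc m)) (selections xs) (x ∘ suc) (λ s → proj₁ s zero)
                               (λ i s → W i (proj₂ s))) ⟩
    rperm (suc m) (tail x ∷ map tail xs)
      + ∑ (selections xs) (λ s → proj₁ s zero * rperm (suc m) (tail x ∷ map tail (proj₂ s))) ∎
    where
    U : Fin (suc m) → ℤ
    U i = rperm m (map (deleteCol i) (map tail xs))
    W : Fin (suc m) → List (Row (suc (suc m))) → ℤ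
    W i ys = rperm m (map (deleteCol i) (map tail ys))
    V : Fin (suc m) → Row (suc (suc m)) × List (Row (suc (suc m))) → ℤ
    V i s = proj₁ s zero * W i (proj₂ s)
    minor-column0 : ∀ i → rperm (suc m) (map (deleteCol (suc i)) xs) ≡ U i + ∑ (selections xs) (V i)
    minor-column0 i = trans (rperm-column0 m (map (deleteCol (suc i)) xs)) (cong₂ _+_
      (cong (rperm m) (tail-deleteCol i xs))
      (trans (∑-selections-map (deleteCol (suc i)) xs (λ s → proj₁ s zero * rperm m (map tail (proj₂ s))))
             (∑-cong (selections xs) (λ s → cong (λ rows → proj₁ s zero * rperm m rows)
                                                (tail-deleteCol i (proj₂ s))))))

  rperm-column0 n []       = refl
  rperm-column0 n (x ∷ xs) = begin
    rperm (suc n) (x ∷ xs)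
      ≡⟨ ∑Fin-suc n (λ i → x i * rperm n (map (deleteCol i) xs)) ⟩
    x zero * rperm n (map tail xs) + ∑Fin n (λ i → x (suc i) * rperm n (map (deleteCol (suc i)) xs))
      ≡⟨ cong (_+_ (x zero * rperm n (map tail xs))) (firstRow-avoiding0 n x xs) ⟩
    x zero * rperm n (map tail xs) + (rperm n (tail x ∷ map tail xs) + S)
      ≡⟨ swap-front (x zero * rperm n (map tail xs)) (rperm n (tail x ∷ map tail xs)) S ⟩
    rperm n (tail x ∷ map tail xs) + (x zero * rperm n (map tail xs) + S)
      ≡⟨ cong (λ s → rperm n (tail x ∷ map tail xs) + (x zero * rperm n (map tail xs) + s))
              (sym (∑-map (selections xs) (Product.map₂ (x ∷_)) _)) ⟩
    column0Expansion n (x ∷ xs) ∎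
    where
    S : ℤ
    S = ∑ (selections xs) (λ s → proj₁ s zero * rperm n (tail x ∷ map tail (proj₂ s)))
    swap-front : ∀ a b c → a + (b + c) ≡ b + (a + c)
    swap-front = solve-∀

  -- Divisibility for repeated rows.

  -- Selecting any of the first m+1 equal elements v gives the same selection.
  selections-replicate : {A : Set} (v : A) (m : ℕ) (rs : List A) (g : A × List A → ℤ) →
    ∑ (selections (replicate (suc m) v ++ rs)) g
      ≡ + suc m * g (v , replicate m v ++ rs)
        + ∑ (selections rs) (λ s → g (proj₁ s , replicate (suc m) v ++ proj₂ s))
  selections-replicate v zero    rs g =
    cong₂ _+_ (sym (*-identityˡ (g (v , rs)))) (∑-map (selections rs) (Product.map₂ (v ∷_)) g)
  selections-replicate {A} v (suc m) rs g = begin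
    g (v , v ∷ rest) + ∑ (map (Product.map₂ (v ∷_)) (selections (v ∷ rest))) g
      ≡⟨ cong (_+_ (g (v , v ∷ rest))) (∑-map (selections (v ∷ rest)) (Product.map₂ (v ∷_)) g) ⟩
    g (v , v ∷ rest) + ∑ (selections (v ∷ rest)) (g ∘ Product.map₂ (v ∷_))
      ≡⟨ cong (_+_ (g (v , v ∷ rest))) (selections-replicate v m rs (g ∘ Product.map₂ (v ∷_))) ⟩
    g (v , v ∷ rest) + (+ suc m * g (v , v ∷ rest) + T)
      ≡⟨ collect (g (v , v ∷ rest)) (+ suc m) T ⟩
    + suc (suc m) * g (v , v ∷ rest) + T ∎
    where
    rest : List A
    rest = replicate m v ++ rs
    T : ℤ
    T = ∑ (selections rs) (λ s → g (proj₁ s , v ∷ v ∷ replicate m v ++ proj₂ s))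
    collect : ∀ X a S → X + (a * X + S) ≡ (+ 1 + a) * X + S
    collect = solve-∀

  map-replicate-++ : {A B : Set} (f : A → B) (m : ℕ) (v : A) (rs : List A) →
    map f (replicate m v ++ rs) ≡ replicate m (f v) ++ map f rs
  map-replicate-++ f m v rs = trans (map-++ f (replicate m v) rs) (cong (_++ map f rs) (map-replicate f m v))

  rperm-repeated : (n m : ℕ) (v : Row n) (rs : List (Row n)) → + suc m ∣ rperm n (replicate (suc m) v ++ rs)
  rperm-repeated zero    m v rs = divides (+ 0) refl
  rperm-repeated (suc n) m v rs =
    subst (+ suc m ∣_) (sym (rperm-column0 n (replicate (suc m) v ++ rs)))
      (∣m∣n⇒∣m+n (repeated-tail rs)
        (subst (+ suc m ∣_) (sym (selections-replicate v m rs (λ s → proj₁ s zero * rperm n (map tail (proj₂ s)))))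
          (∣m∣n⇒∣m+n (∣m⇒∣m*n (v zero * rperm n (map tail (replicate m v ++ rs))) ∣-refl)
                      (∑-∣ (selections rs) (λ s → ∣n⇒∣m*n (proj₁ s zero) (repeated-tail (proj₂ s)))))))
    where
    repeated-tail : ∀ ys → + suc m ∣ rperm n (map tail (replicate (suc m) v ++ ys))
    repeated-tail ys = subst (λ rows → + suc m ∣ rperm n rows) (sym (map-replicate-++ tail (suc m) v ys))
                             (rperm-repeated n m (tail v) (map tail ys))

  -- If d divides the permanent of every list of the form b ∷ W ++ B, then replacing t copies of a by
  -- a + c·b in front of any U ++ B does not change the permanent modulo d: by linearity each
  -- replacement changes it by c·rperm (b ∷ …).
  replaceCopies : (n : ℕ) {d : ℤ} (a b : Row n) (c : ℤ) (B : List (Row n)) →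
    (∀ W → d ∣ rperm n (b ∷ W ++ B)) →
    ∀ t U → d ∣ rperm n (replicate t a ++ U ++ B) - rperm n (replicate t (a ⊕ c · b) ++ U ++ B)
  replaceCopies n {d} a b c B absorbs zero U =
    subst (d ∣_) (sym (+-inverseʳ (rperm n (U ++ B)))) (divides (+ 0) (sym (*-zeroˡ d)))
  replaceCopies n {d} a b c B absorbs (suc t) U =
    subst (d ∣_) (sym difference)
          (∣m∣n⇒∣m-n (replaceCopies n a b c B absorbs t (a ∷ U)) (∣n⇒∣m*n c b-term))
    where
    a' : Row n
    a' = a ⊕ c · b
    X Y Q : ℤ
    X = rperm n (replicate t a ++ (a ∷ U) ++ B)
    Y = rperm n (replicate t a' ++ (a ∷ U) ++ B)
    Q = rperm n (b ∷ replicate t a' ++ U ++ B)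
    b-term : d ∣ Q
    b-term = subst (λ rows → d ∣ rperm n (b ∷ rows)) (++-assoc (replicate t a') U B) (absorbs (replicate t a' ++ U))
    moveFront : ∀ (e : Row n) xs → rperm n (e ∷ xs ++ U ++ B) ≡ rperm n (xs ++ (e ∷ U) ++ B)
    moveFront e xs = rperm-↭ n (↭-sym (shift e xs (U ++ B)))
    difference : rperm n (a ∷ replicate t a ++ U ++ B) - rperm n (a' ∷ replicate t a' ++ U ++ B) ≡ X - Y - c * Q
    difference = begin
      rperm n (a ∷ replicate t a ++ U ++ B) - rperm n (a' ∷ replicate t a' ++ U ++ B)
        ≡⟨ cong₂ _-_ (moveFront a (replicate t a))
                     (trans (rperm-linear n a b c _) (cong (_+ c * Q) (moveFront a (replicate t a')))) ⟩
      X - (Y + c * Q)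
        ≡⟨ reassoc X Y (c * Q) ⟩
      X - Y - c * Q ∎
      where reassoc : ∀ x y z → x - (y + z) ≡ x - y - z
            reassoc = solve-∀

  rowOperation-congruence : (n k : ℕ) (a b : Row n) (c : ℤ) (S : List (Row n)) →
    + suc k ∣ rperm n (replicate k a ++ replicate k b ++ S) - rperm n (replicate k (a ⊕ c · b) ++ replicate k b ++ S)
  rowOperation-congruence n k a b c S = replaceCopies n a b c (replicate k b ++ S) absorbs k []
    where
    absorbs : ∀ W → + suc k ∣ rperm n (b ∷ W ++ replicate k b ++ S)
    absorbs W = subst (+ suc k ∣_) (rperm-↭ n (↭-prep b (↭-sym (shifts W (replicate k b)))))
                      (rperm-repeated n k b (W ++ S))

  -- Rows of a stacked matrix.

  copies : {A : Set} → ℕ → List A → List A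
  copies zero    xs = []
  copies (suc k) xs = xs ++ copies k xs

  copies-map : {A B : Set} (f : A → B) (k : ℕ) (xs : List A) → map f (copies k xs) ≡ copies k (map f xs)
  copies-map f zero    xs = refl
  copies-map f (suc k) xs = trans (map-++ f xs (copies k xs)) (cong (map f xs ++_) (copies-map f k xs))

  copies-↭ : {A : Set} (k : ℕ) {xs ys : List A} → xs ↭ ys → copies k xs ↭ copies k ys
  copies-↭ zero    xs↭ys = ↭-refl
  copies-↭ (suc k) xs↭ys = ++⁺ xs↭ys (copies-↭ k xs↭ys)

  gather : {A : Set} (k : ℕ) (a b : A) (R : List A) →
    copies k (a ∷ b ∷ R) ↭ replicate k a ++ replicate k b ++ copies k R
  gather zero    a b R = ↭-refl
  gather (suc k) a b R =
    ↭-prep a (↭-trans (↭-prep b rest-behind) (↭-sym (shift b (replicate k a) (replicate k b ++ R ++ copies k R))))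
    where
    rest-behind : R ++ copies k (a ∷ b ∷ R) ↭ replicate k a ++ replicate k b ++ R ++ copies k R
    rest-behind = ↭-trans (++⁺ˡ R (gather k a b R))
                 (↭-trans (shifts R (replicate k a)) (++⁺ˡ (replicate k a) (shifts R (replicate k b))))

  allFin-+ : (m n : ℕ) → allFin (m +ℕ n) ≡ map (_↑ˡ n) (allFin m) ++ map (m ↑ʳ_) (allFin n)
  allFin-+ zero    n = sym (map-id (allFin n))
  allFin-+ (suc m) n = cong (zero ∷_) (begin
    map suc (allFin (m +ℕ n))
      ≡⟨ cong (map suc) (allFin-+ m n) ⟩
    map suc (map (_↑ˡ n) (allFin m) ++ map (m ↑ʳ_) (allFin n))
      ≡⟨ map-++ suc (map (_↑ˡ n) (allFin m)) (map (m ↑ʳ_) (allFin n)) ⟩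
    map suc (map (_↑ˡ n) (allFin m)) ++ map suc (map (m ↑ʳ_) (allFin n))
      ≡⟨ cong₂ _++_ (trans (sym (map-∘ (allFin m))) (map-∘ (allFin m))) (sym (map-∘ (allFin n))) ⟩
    map (_↑ˡ n) (map suc (allFin m)) ++ map (suc m ↑ʳ_) (allFin n) ∎)

  remQuot-rows : (k p : ℕ) → map (proj₂ ∘ remQuot {k} p) (allFin (k *ℕ p)) ≡ copies k (allFin p)
  remQuot-rows zero    p = refl
  remQuot-rows (suc k) p = begin
    map (proj₂ ∘ remQuot {suc k} p) (allFin (p +ℕ k *ℕ p))
      ≡⟨ cong (map (proj₂ ∘ remQuot {suc k} p)) (allFin-+ p (k *ℕ p)) ⟩
    map (proj₂ ∘ remQuot {suc k} p) (map (_↑ˡ k *ℕ p) (allFin p) ++ map (p ↑ʳ_) (allFin (k *ℕ p)))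
      ≡⟨ map-++ _ (map (_↑ˡ k *ℕ p) (allFin p)) (map (p ↑ʳ_) (allFin (k *ℕ p))) ⟩
    map (proj₂ ∘ remQuot {suc k} p) (map (_↑ˡ k *ℕ p) (allFin p))
      ++ map (proj₂ ∘ remQuot {suc k} p) (map (p ↑ʳ_) (allFin (k *ℕ p)))
      ≡⟨ cong₂ _++_ (trans (sym (map-∘ (allFin p))) (trans (map-cong first-block (allFin p)) (map-id (allFin p))))
                    (trans (sym (map-∘ (allFin (k *ℕ p)))) (map-cong later-blocks (allFin (k *ℕ p)))) ⟩
    allFin p ++ map (proj₂ ∘ remQuot {k} p) (allFin (k *ℕ p))
      ≡⟨ cong (allFin p ++_) (remQuot-rows k p) ⟩
    copies (suc k) (allFin p) ∎
    where
    first-block : ∀ x → proj₂ (remQuot {suc k} p (x ↑ˡ k *ℕ p)) ≡ x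
    first-block x = cong proj₂ (remQuot-combine {suc k} {p} zero x)
    later-blocks : ∀ y → proj₂ (remQuot {suc k} p (p ↑ʳ y)) ≡ proj₂ (remQuot {k} p y)
    later-blocks y rewrite splitAt-↑ʳ p (k *ℕ p) y = refl

  Perm-stack : (k : ℕ) {p : ℕ} (N : Matrix p (k *ℕ p)) {xs : List (Fin p)} →
    allFin p ↭ xs → Perm (stack k N) ≡ rperm (k *ℕ p) (copies k (map N xs))
  Perm-stack k {p} N {xs} allFin↭xs = begin
    Perm (stack k N)
      ≡⟨ Perm≡rperm (k *ℕ p) (stack k N) ⟩
    rperm (k *ℕ p) (map (stack k N) (allFin (k *ℕ p)))
      ≡⟨ cong (rperm (k *ℕ p)) stack-rows ⟩
    rperm (k *ℕ p) (copies k (map N (allFin p)))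
      ≡⟨ rperm-↭ (k *ℕ p) (copies-↭ k (↭-map⁺ N allFin↭xs)) ⟩
    rperm (k *ℕ p) (copies k (map N xs)) ∎
    where
    stack-rows : map (stack k N) (allFin (k *ℕ p)) ≡ copies k (map N (allFin p))
    stack-rows = begin
      map (N ∘ proj₂ ∘ remQuot {k} p) (allFin (k *ℕ p)) ≡⟨ map-∘ (allFin (k *ℕ p)) ⟩
      map N (map (proj₂ ∘ remQuot {k} p) (allFin (k *ℕ p))) ≡⟨ cong (map N) (remQuot-rows k p) ⟩
      map N (copies k (allFin p))                        ≡⟨ copies-map N k (allFin p) ⟩
      copies k (map N (allFin p))                        ∎

  allFin-remove : {p : ℕ} (i : Fin (suc p)) → allFin (suc p) ↭ i ∷ map (punchIn i) (allFin p)
  allFin-remove         zero    = ↭-refl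
  allFin-remove {suc p} (suc i) = ↭-trans (↭-prep zero (↭-map⁺ suc (allFin-remove i)))
    (↭-swap zero (suc i) (↭-reflexive (trans (sym (map-∘ (allFin p))) (map-∘ (allFin p)))))

  allFin-split : {p : ℕ} (i j : Fin p) → i ≢ j → ∃ λ L → (allFin p ↭ i ∷ j ∷ L) × All (_≢ i) L
  allFin-split {suc zero}    zero zero i≢j = contradiction refl i≢j
  allFin-split {suc (suc p)} i    j    i≢j =
    map (punchIn i) (map (punchIn j') (allFin p)) ,
    ↭-trans (allFin-remove i) (↭-prep i (↭-trans (↭-map⁺ (punchIn i) (allFin-remove j'))
                                         (↭-reflexive (cong (_∷ map (punchIn i) (map (punchIn j') (allFin p)))
                                                            (punchIn-punchOut i≢j))))) ,
    All-map⁺ (universal (punchInᵢ≢i i) _)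
    where j' : Fin (suc p)
          j' = punchOut i≢j

  addRowMultiple-rows : {p q : ℕ} (i j : Fin p) (c : ℤ) (N : Matrix p q) {L : List (Fin p)} → i ≢ j →
    All (_≢ i) L → map (addRowMultiple i j c N) (i ∷ j ∷ L) ≡ (N i ⊕ c · N j) ∷ N j ∷ map N L
  addRowMultiple-rows i j c N i≢j L≢i =
    cong₂ _∷_ target
      (cong₂ _∷_ (unchanged j (i≢j ∘ sym)) (map-cong-local (All.map (λ {x} → unchanged x) L≢i)))
    where
    target : addRowMultiple i j c N i ≡ N i ⊕ c · N j
    target with i ≟ i
    ... | yes _   = refl
    ... | no  i≢i = contradiction refl i≢i
    unchanged : ∀ x → x ≢ i → addRowMultiple i j c N x ≡ N x
    unchanged x x≢i with x ≟ i
    ... | yes x≡i = contradiction x≡i x≢i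
    ... | no  _   = refl

open import Defs
open import Data.Nat using (ℕ; suc; _*_; NonZero)
open import Data.Integer using (ℤ; +_; _-_)
open import Data.Integer.Divisibility using (_∣_)
open import Data.Fin using (Fin)
open import Relation.Binary.PropositionalEquality using (_≢_)

open import Data.List using (List; _∷_; _++_; map; replicate)
open import Data.Product using (_,_)
open import Function using (_∘_)
open import Relation.Binary.PropositionalEquality using (_≡_; cong; cong₂; sym; trans; subst; module ≡-Reasoning)
import Data.Integer.Divisibility.Signed as Signed
open RowPermanents

-- With L the row indices other than i and j, the stacked matrices have, up to reordering, the rows
-- a^k ++ (N j)^k ++ copies k (rows L) with a = N i resp. a = N i + c·N j; rowOperation-congruence
-- compares the two permanents.
corollary2p6 : (p k : ℕ) → .{{_ : NonZero k}} → (N : Matrix p (k * p))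
    → (i j : Fin p) → i ≢ j → (c : ℤ)
    → + (suc k) ∣ (Perm (stack k N) - Perm (stack k (addRowMultiple i j c N)))
corollary2p6 p k N i j i≢j c with allFin-split i j i≢j
... | L , allFin↭ , L≢i =
  Signed.∣⇒∣ᵤ (subst (Signed._∣_ (+ suc k)) (sym (cong₂ _-_ rows rows'))
                     (rowOperation-congruence (k * p) k (N i) (N j) c others))
  where
  open ≡-Reasoning
  others : List (Row (k * p))
  others = copies k (map N L)
  rows : Perm (stack k N) ≡ rperm (k * p) (replicate k (N i) ++ replicate k (N j) ++ others)
  rows = trans (Perm-stack k N allFin↭) (rperm-↭ (k * p) (gather k (N i) (N j) (map N L)))
  rows' : Perm (stack k (addRowMultiple i j c N))
          ≡ rperm (k * p) (replicate k (N i ⊕ c · N j) ++ replicate k (N j) ++ others)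
  rows' = begin
    Perm (stack k (addRowMultiple i j c N))
      ≡⟨ Perm-stack k (addRowMultiple i j c N) allFin↭ ⟩
    rperm (k * p) (copies k (map (addRowMultiple i j c N) (i ∷ j ∷ L)))
      ≡⟨ cong (rperm (k * p) ∘ copies k) (addRowMultiple-rows i j c N i≢j L≢i) ⟩
    rperm (k * p) (copies k ((N i ⊕ c · N j) ∷ N j ∷ map N L))
      ≡⟨ rperm-↭ (k * p) (gather k (N i ⊕ c · N j) (N j) (map N L)) ⟩
    rperm (k * p) (replicate k (N i ⊕ c · N j) ++ replicate k (N j) ++ others) ∎
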